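{- Let $n \ge 1$ and let $h_1 \ge h_2 \ge \cdots \ge h_n > 0$ be growth rates with $\sum_{i=1}^n h_i = 1$. Run the bamboo trimming process with the Reduce-Max algorithm (in each step, after every bamboo $b_i$ grows by $h_i$, a tallest bamboo is cut to height $0$, ties broken arbitrarily), starting from all heights $0$. For $t \in \mathbb{N}\cup\{0\}$ let $|b_i|_t$ denote the height of $b_i$ after the $t$-th cut ($|b_i|_0 = 0$). For $i \in [n]$ define \[V(i,t) = \sum_{k=1}^{i} \min(2, |b_k|_t), \qquad \Phi(i,t) = \sum_{\substack{k \in [i] \\ 2(k-1) < V(i,t)}} h_k \cdot \min\bigl(2, V(i,t) - 2(k-1)\bigr).\] Then for all $i \in [n]$ and all $t \in \mathbb{N} \cup \{0\}$, \[|b_i|_t \le 4 - \Phi(i,t) \le 4.\]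
   Context: Bamboo trimming problem: bamboo $b_1,\dots,b_n$ with growth rates $h_i>0$ summing to $1$, all starting at height $0$; each time step consists of every $b_i$ growing by $h_i$, after which the algorithm cuts one chosen bamboo to height $0$. Reduce-Max always cuts a bamboo of maximum height (measured after the growth of that step).
   Formalization: The growth rates $h_i$ are rational numbers. -}

module Defs where

open import Data.Nat as ℕ using (ℕ; zero; suc)
open import Data.Fin using (Fin; toℕ; _≟_)
import Data.Fin as F
open import Data.Bool using (Bool; true; false; if_then_else_; _∧_)
open import Data.Rational using (ℚ; 0ℚ; _+_; _*_; _-_; _⊓_; _<_; _≤_)
import Data.Rational
open import Data.Rational.Properties using (_<?_)
open import Relation.Nullary.Decidable using (⌊_⌋)
import Data.Nat.Properties as ℕP

ℕ→ℚ : ℕ → ℚ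
ℕ→ℚ m = Data.Rational.normalize m 1

two : ℚ
two = ℕ→ℚ 2

Σ[Fin] : ∀ {n} → (Fin n → ℚ) → ℚ
Σ[Fin] {zero} f = 0ℚ
Σ[Fin] {suc n} f = f F.zero + Σ[Fin] (λ k → f (F.suc k))

-- height of bamboo i after the t-th cut, given growth rates h and a cut
-- schedule (cut t = bamboo cut in step t+1).
height : ∀ {n} → (Fin n → ℚ) → (ℕ → Fin n) → ℕ → Fin n → ℚ
height h cut zero i = 0ℚ
height h cut (suc t) i =
  if ⌊ i ≟ cut t ⌋ then 0ℚ else height h cut t i + h i

IsReduceMax : ∀ {n} → (Fin n → ℚ) → (ℕ → Fin n) → Set
IsReduceMax h cut = ∀ t j →
  height h cut t j + h j ≤ height h cut t (cut t) + h (cut t)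

V : ∀ {n} → (Fin n → ℚ) → (ℕ → Fin n) → Fin n → ℕ → ℚ
V h cut i t =
  Σ[Fin] (λ k → if ⌊ toℕ k ℕP.≤? toℕ i ⌋ then two ⊓ height h cut t k else 0ℚ)

-- Φ(i,t) = Σ_{k ≤ i, 2(k-1) < V(i,t)} h_k · min(2, V(i,t) − 2(k−1))
-- with 1-based k; here k is 0-based, so 2(k-1) becomes 2·toℕ k.
Φ : ∀ {n} → (Fin n → ℚ) → (ℕ → Fin n) → Fin n → ℕ → ℚ
Φ h cut i t =
  Σ[Fin] (λ k →
    if ⌊ toℕ k ℕP.≤? toℕ i ⌋ ∧ ⌊ ℕ→ℚ (2 ℕ.* toℕ k) <? V h cut i t ⌋
    then h k * (two ⊓ (V h cut i t - ℕ→ℚ (2 ℕ.* toℕ k)))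
    else 0ℚ)

-- Write Φ(i,t) = F_i(V(i,t)), where F_i(W) = Σ_{k ≤ i} h_k · min(2, max(0, W − 2k)) is piecewise
-- linear with slope h_k on (2k, 2k + 2) (indices from 0). As the h_k decrease and sum to 1,
-- F_i ≤ 2 and F_i gains at least h_i on every unit interval inside [0, 2i + 2].
-- By induction on t, |b_i|_t + F_i(V(i,t)) ≤ 4. If b_i grows to at most 2 this is F_i ≤ 2.
-- Otherwise the bamboo b_c cut by Reduce-Max is at least as tall; for j = max(i, c) the cut
-- removes 2 from V(j,·) while growth adds at most 1, so V(i,t+1) + 1 ≤ V(j,t) and
--   |b_i|_t + h_i + F_i(V(i,t+1)) ≤ |b_j|_t + h_j + F_j(V(i,t+1)) ≤ |b_j|_t + F_j(V(j,t)) ≤ 4.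

{-# OPTIONS --safe #-}
module Submission where

open import Defs
open import Data.Nat using (ℕ; suc)
import Data.Nat as ℕ
open import Data.Fin using (Fin; toℕ)
open import Data.Product using (_×_)
open import Relation.Binary.PropositionalEquality using (_≡_)
open import Data.Rational using (ℚ; 0ℚ; 1ℚ; _-_; _<_; _≤_)

open import Data.Nat using (zero)
import Data.Nat.Properties as ℕP
import Data.Fin as F
open import Data.Fin.Properties using (toℕ<n)
open import Data.Product using (_,_)
open import Data.Sum using (inj₁; inj₂; [_,_]′)
open import Data.Empty using (⊥-elim)
open import Data.Bool using (if_then_else_; _∧_)
open import Function using (_∘_)
open import Relation.Nullary using (Dec; yes; no; ¬_)
open import Relation.Nullary.Decidable using (⌊_⌋; toSum)
open import Relation.Binary.PropositionalEquality
  using (refl; sym; trans; cong; cong₂; module ≡-Reasoning)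
import Data.Integer as ℤ
import Data.Integer.Properties as ℤP
open import Data.Nat.Coprimality using (1-coprimeTo) renaming (sym to coprime-sym)
open import Data.Rational using (_+_; _*_; -_; _⊓_; _⊔_; nonNegative)
import Data.Rational.Properties as ℚP
open ℚP using (≤-refl; ≤-trans; ≤-reflexive; <⇒≤; +-mono-≤; +-monoˡ-≤; +-monoʳ-≤)
open import Data.Rational.Solver using (module +-*-Solver)
open +-*-Solver using (solve; _:+_; _:-_; _:*_; _:=_; con)

p≤p+q : ∀ {p q} → 0ℚ ≤ q → p ≤ p + q
p≤p+q {p} 0≤q = ≤-trans (≤-reflexive (sym (ℚP.+-identityʳ p))) (+-monoʳ-≤ p 0≤q)

p≤q⇒0≤q-p : ∀ {p q} → p ≤ q → 0ℚ ≤ q - p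
p≤q⇒0≤q-p {p} p≤q = ≤-trans (≤-reflexive (sym (ℚP.+-inverseʳ p))) (+-monoˡ-≤ (- p) p≤q)

p≤q⇒p-q≤0 : ∀ {p q} → p ≤ q → p - q ≤ 0ℚ
p≤q⇒p-q≤0 {p} {q} p≤q = ≤-trans (+-monoˡ-≤ (- q) p≤q) (≤-reflexive (ℚP.+-inverseʳ q))

[p+q]-q≡p : ∀ p q → (p + q) - q ≡ p
[p+q]-q≡p = solve 2 (λ p q → p :+ q :- q := p) refl

p+q≤r⇒p≤r-q : ∀ {p q r} → p + q ≤ r → p ≤ r - q
p+q≤r⇒p≤r-q {p} {q} p+q≤r = ≤-trans (≤-reflexive (sym ([p+q]-q≡p p q))) (+-monoˡ-≤ (- q) p+q≤r)

p≤q+r⇒p-q≤r : ∀ {p q r} → p ≤ q + r → p - q ≤ r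
p≤q+r⇒p-q≤r {p} {q} {r} p≤q+r =
  ≤-trans (+-monoˡ-≤ (- q) p≤q+r) (≤-reflexive (trans (cong (_- q) (ℚP.+-comm q r)) ([p+q]-q≡p r q)))

+-cancelʳ-≤ : ∀ {p q} r → p + r ≤ q + r → p ≤ q
+-cancelʳ-≤ {p} {q} r p+r≤q+r =
  ≤-trans (≤-reflexive (sym ([p+q]-q≡p p r)))
          (≤-trans (+-monoˡ-≤ (- r) p+r≤q+r) (≤-reflexive ([p+q]-q≡p q r)))

p-q≤p : ∀ {p q} → 0ℚ ≤ q → p - q ≤ p
p-q≤p {p} 0≤q = ≤-trans (+-monoʳ-≤ p (ℚP.neg-antimono-≤ 0≤q)) (≤-reflexive (ℚP.+-identityʳ p))

*-monoˡ-≤ : ∀ {r p q} → 0ℚ ≤ r → p ≤ q → r * p ≤ r * q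
*-monoˡ-≤ {r} 0≤r = ℚP.*-monoˡ-≤-nonNeg r {{nonNegative 0≤r}}

*-monoʳ-≤ : ∀ {r p q} → 0ℚ ≤ r → p ≤ q → p * r ≤ q * r
*-monoʳ-≤ {r} 0≤r = ℚP.*-monoʳ-≤-nonNeg r {{nonNegative 0≤r}}

*-nonNeg : ∀ {p q} → 0ℚ ≤ p → 0ℚ ≤ q → 0ℚ ≤ p * q
*-nonNeg {p} 0≤p 0≤q = ≤-trans (≤-reflexive (sym (ℚP.*-zeroʳ p))) (*-monoˡ-≤ 0≤p 0≤q)

rearrangement : ∀ {a c r r′} → c ≤ a → r ≤ r′ → a * r + c * r′ ≤ a * r′ + c * r
rearrangement {a} {c} {r} {r′} c≤a r≤r′ = ≤-trans
  (p≤p+q (*-nonNeg (p≤q⇒0≤q-p c≤a) (p≤q⇒0≤q-p r≤r′)))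
  (≤-reflexive (identity a c r r′))
  where
    identity : ∀ a c r r′ → a * r + c * r′ + (a - c) * (r′ - r) ≡ a * r′ + c * r
    identity = solve 4 (λ a c r r′ → a :* r :+ c :* r′ :+ (a :- c) :* (r′ :- r) := a :* r′ :+ c :* r) refl

⊓-distribʳ-+ : ∀ p q r → (p ⊓ q) + r ≡ (p + r) ⊓ (q + r)
⊓-distribʳ-+ p q r = ℚP.mono-≤-distrib-⊓ (+-monoˡ-≤ r) p q

ℕ→ℚ-+ : ∀ m n → ℕ→ℚ (m ℕ.+ n) ≡ ℕ→ℚ m + ℕ→ℚ n
ℕ→ℚ-+ m n = sym (trans
  (cong₂ _+_ (ℚP.normalize-coprime (coprime-sym (1-coprimeTo m)))
             (ℚP.normalize-coprime (coprime-sym (1-coprimeTo n))))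
  (cong₂ (λ x y → (x ℤ.+ y) Data.Rational./ 1) (ℤP.*-identityʳ (ℤ.+ m)) (ℤP.*-identityʳ (ℤ.+ n))))

ℕ→ℚ-nonNeg : ∀ m → 0ℚ ≤ ℕ→ℚ m
ℕ→ℚ-nonNeg m = ℚP.nonNegative⁻¹ (ℕ→ℚ m) {{ℚP.normalize-nonNeg m 1}}

ℕ→ℚ-mono-≤ : ∀ {m n} → m ℕ.≤ n → ℕ→ℚ m ≤ ℕ→ℚ n
ℕ→ℚ-mono-≤ {m} {n} m≤n = ≤-trans (p≤p+q (ℕ→ℚ-nonNeg (n ℕ.∸ m)))
  (≤-reflexive (trans (sym (ℕ→ℚ-+ m (n ℕ.∸ m))) (cong ℕ→ℚ (ℕP.m+[n∸m]≡n m≤n))))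

ℕ→ℚ-cancel-< : ∀ {m n} → ℕ→ℚ m < ℕ→ℚ n → m ℕ.< n
ℕ→ℚ-cancel-< m<n = ℕP.≰⇒> (λ n≤m → ℚP.<-irrefl refl (ℚP.<-≤-trans m<n (ℕ→ℚ-mono-≤ n≤m)))

ℕ→ℚ-2*suc : ∀ m → ℕ→ℚ (2 ℕ.* suc m) ≡ two + ℕ→ℚ (2 ℕ.* m)
ℕ→ℚ-2*suc m = trans (cong ℕ→ℚ (ℕP.*-suc 2 m)) (ℕ→ℚ-+ 2 (2 ℕ.* m))

0≤two : 0ℚ ≤ two
0≤two = ℕ→ℚ-nonNeg 2

Σ[Fin]-cong : ∀ {n} {f g : Fin n → ℚ} → (∀ k → f k ≡ g k) → Σ[Fin] f ≡ Σ[Fin] g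
Σ[Fin]-cong {zero}  f≡g = refl
Σ[Fin]-cong {suc n} f≡g = cong₂ _+_ (f≡g F.zero) (Σ[Fin]-cong (f≡g ∘ F.suc))

Σ[Fin]-mono-≤ : ∀ {n} {f g : Fin n → ℚ} → (∀ k → f k ≤ g k) → Σ[Fin] f ≤ Σ[Fin] g
Σ[Fin]-mono-≤ {zero}  f≤g = ≤-refl
Σ[Fin]-mono-≤ {suc n} f≤g = +-mono-≤ (f≤g F.zero) (Σ[Fin]-mono-≤ (f≤g ∘ F.suc))

Σ[Fin]-mono-≤-at : ∀ {n} {f g : Fin n → ℚ} {e} → (∀ k → f k ≤ g k) →
                   ∀ m → f m + e ≤ g m → Σ[Fin] f + e ≤ Σ[Fin] g
Σ[Fin]-mono-≤-at {suc n} {f} {g} {e} f≤g F.zero fm+e≤gm = begin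
  f F.zero + Σ[Fin] (f ∘ F.suc) + e  ≡⟨ +-swapʳ (f F.zero) _ e ⟩
  f F.zero + e + Σ[Fin] (f ∘ F.suc)  ≤⟨ +-mono-≤ fm+e≤gm (Σ[Fin]-mono-≤ (f≤g ∘ F.suc)) ⟩
  Σ[Fin] g                          ∎
  where
    open ℚP.≤-Reasoning
    +-swapʳ : ∀ a b c → a + b + c ≡ a + c + b
    +-swapʳ = solve 3 (λ a b c → a :+ b :+ c := a :+ c :+ b) refl
Σ[Fin]-mono-≤-at {suc n} {f} {g} {e} f≤g (F.suc m) fm+e≤gm = begin
  f F.zero + Σ[Fin] (f ∘ F.suc) + e
    ≡⟨ ℚP.+-assoc (f F.zero) _ e ⟩
  f F.zero + (Σ[Fin] (f ∘ F.suc) + e)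
    ≤⟨ +-mono-≤ (f≤g F.zero) (Σ[Fin]-mono-≤-at (f≤g ∘ F.suc) m fm+e≤gm) ⟩
  Σ[Fin] g ∎
  where open ℚP.≤-Reasoning

Σ[Fin]-nonNeg : ∀ {n} {f : Fin n → ℚ} → (∀ k → 0ℚ ≤ f k) → 0ℚ ≤ Σ[Fin] f
Σ[Fin]-nonNeg {zero}  0≤f = ≤-refl
Σ[Fin]-nonNeg {suc n} 0≤f = +-mono-≤ (0≤f F.zero) (Σ[Fin]-nonNeg (0≤f ∘ F.suc))

Σ[Fin]-zero : ∀ {n} → Σ[Fin] {n} (λ _ → 0ℚ) ≡ 0ℚ
Σ[Fin]-zero {zero}  = refl
Σ[Fin]-zero {suc n} = cong (0ℚ +_) (Σ[Fin]-zero {n})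

Σ[Fin]-distrib-+ : ∀ {n} (f g : Fin n → ℚ) → Σ[Fin] (λ k → f k + g k) ≡ Σ[Fin] f + Σ[Fin] g
Σ[Fin]-distrib-+ {zero}  f g = refl
Σ[Fin]-distrib-+ {suc n} f g = trans
  (cong (f F.zero + g F.zero +_) (Σ[Fin]-distrib-+ (f ∘ F.suc) (g ∘ F.suc)))
  (+-interchange (f F.zero) (g F.zero) _ _)
  where
    +-interchange : ∀ a b c d → a + b + (c + d) ≡ a + c + (b + d)
    +-interchange = solve 4 (λ a b c d → a :+ b :+ (c :+ d) := a :+ c :+ (b :+ d)) refl

*-distribˡ-Σ[Fin] : ∀ {n} c (f : Fin n → ℚ) → c * Σ[Fin] f ≡ Σ[Fin] (λ k → c * f k)
*-distribˡ-Σ[Fin] {zero}  c f = ℚP.*-zeroʳ c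
*-distribˡ-Σ[Fin] {suc n} c f = trans (ℚP.*-distribˡ-+ c (f F.zero) _)
  (cong (c * f F.zero +_) (*-distribˡ-Σ[Fin] c (f ∘ F.suc)))

*-distribʳ-Σ[Fin] : ∀ {n} c (f : Fin n → ℚ) → Σ[Fin] f * c ≡ Σ[Fin] (λ k → f k * c)
*-distribʳ-Σ[Fin] c f = trans (ℚP.*-comm _ c)
  (trans (*-distribˡ-Σ[Fin] c f) (Σ[Fin]-cong (λ k → ℚP.*-comm c (f k))))

prefix : ∀ {n} → Fin n → (Fin n → ℚ) → Fin n → ℚ
prefix i f k = if ⌊ toℕ k ℕP.≤? toℕ i ⌋ then f k else 0ℚ

module _ {n} {f : Fin n → ℚ} where

  prefix-inside : ∀ i k → toℕ k ℕ.≤ toℕ i → prefix i f k ≡ f k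
  prefix-inside i k k≤i with toℕ k ℕP.≤? toℕ i
  ... | yes _   = refl
  ... | no  k≰i = ⊥-elim (k≰i k≤i)

  prefix-nonNeg : (∀ k → 0ℚ ≤ f k) → ∀ i k → 0ℚ ≤ prefix i f k
  prefix-nonNeg 0≤f i k with toℕ k ℕP.≤? toℕ i
  ... | yes _ = 0≤f k
  ... | no  _ = ≤-refl

  prefix-≤ : (∀ k → 0ℚ ≤ f k) → ∀ i k → prefix i f k ≤ f k
  prefix-≤ 0≤f i k with toℕ k ℕP.≤? toℕ i
  ... | yes _ = ≤-refl
  ... | no  _ = 0≤f k

  prefix-mono-index : (∀ k → 0ℚ ≤ f k) → ∀ {i j} → toℕ i ℕ.≤ toℕ j →
                      ∀ k → prefix i f k ≤ prefix j f k
  prefix-mono-index 0≤f {i} {j} i≤j k with toℕ k ℕP.≤? toℕ i | toℕ k ℕP.≤? toℕ j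
  ... | yes _   | yes _   = ≤-refl
  ... | yes k≤i | no  k≰j = ⊥-elim (k≰j (ℕP.≤-trans k≤i i≤j))
  ... | no  _   | yes _   = 0≤f k
  ... | no  _   | no  _   = ≤-refl

  prefix-mono : ∀ {g : Fin n → ℚ} → (∀ k → f k ≤ g k) → ∀ i k → prefix i f k ≤ prefix i g k
  prefix-mono f≤g i k with toℕ k ℕP.≤? toℕ i
  ... | yes _ = f≤g k
  ... | no  _ = ≤-refl

  prefix-+ : ∀ (g : Fin n → ℚ) i k → prefix i (λ k → f k + g k) k ≡ prefix i f k + prefix i g k
  prefix-+ g i k with toℕ k ℕP.≤? toℕ i
  ... | yes _ = refl
  ... | no  _ = refl

prefix-suc : ∀ {n} (f : Fin (suc n) → ℚ) i k → prefix (F.suc i) f (F.suc k) ≡ prefix i (f ∘ F.suc) k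
prefix-suc f i k with toℕ k ℕP.≤? toℕ i | suc (toℕ k) ℕP.≤? suc (toℕ i)
... | yes _   | yes _     = refl
... | no  _   | no  _     = refl
... | yes k≤i | no  k≰i   = ⊥-elim (k≰i (ℕ.s≤s k≤i))
... | no  k≰i | yes 1+k≤i = ⊥-elim (k≰i (ℕP.≤-pred 1+k≤i))

Σ[Fin]-prefix-≤ : ∀ {n} {f : Fin n → ℚ} → (∀ k → f k ≤ two) → ∀ i →
                  Σ[Fin] (prefix i f) ≤ ℕ→ℚ (2 ℕ.* suc (toℕ i))
Σ[Fin]-prefix-≤ {suc n} f≤2 F.zero = ≤-trans
  (+-mono-≤ (f≤2 F.zero) (≤-reflexive (Σ[Fin]-zero {n})))
  (≤-reflexive (ℚP.+-identityʳ two))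
Σ[Fin]-prefix-≤ {suc n} {f} f≤2 (F.suc i) = ≤-trans
  (+-mono-≤ (f≤2 F.zero) (≤-trans (≤-reflexive (Σ[Fin]-cong (prefix-suc f i)))
                                  (Σ[Fin]-prefix-≤ (f≤2 ∘ F.suc) i)))
  (≤-reflexive (sym (ℕ→ℚ-2*suc (suc (toℕ i)))))

ramp : ℚ → ℚ
ramp x = two ⊓ (0ℚ ⊔ x)

ramp-nonNeg : ∀ x → 0ℚ ≤ ramp x
ramp-nonNeg x = ℚP.⊓-glb 0≤two (ℚP.p≤p⊔q 0ℚ x)

ramp-≤-two : ∀ x → ramp x ≤ two
ramp-≤-two x = ℚP.p⊓q≤p two (0ℚ ⊔ x)

ramp-mono-≤ : ∀ {x y} → x ≤ y → ramp x ≤ ramp y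
ramp-mono-≤ x≤y = ℚP.⊓-monoʳ-≤ two (ℚP.⊔-monoʳ-≤ 0ℚ x≤y)

ramp-nonPos : ∀ {x} → x ≤ 0ℚ → ramp x ≡ 0ℚ
ramp-nonPos x≤0 = trans (cong (two ⊓_) (ℚP.p≥q⇒p⊔q≡p x≤0)) (ℚP.p≥q⇒p⊓q≡q 0≤two)

ramp-+-⊔ : ∀ x → ramp x + (0ℚ ⊔ (x - two)) ≡ 0ℚ ⊔ x
ramp-+-⊔ x with ℚP.≤-total x two
... | inj₁ x≤2 = begin
  ramp x + (0ℚ ⊔ (x - two)) ≡⟨ cong₂ _+_ ramp-x excess ⟩
  (0ℚ ⊔ x) + 0ℚ            ≡⟨ ℚP.+-identityʳ (0ℚ ⊔ x) ⟩
  0ℚ ⊔ x                  ∎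
  where
    open ≡-Reasoning
    ramp-x : ramp x ≡ 0ℚ ⊔ x
    ramp-x = ℚP.p≥q⇒p⊓q≡q (ℚP.⊔-lub 0≤two x≤2)
    excess : 0ℚ ⊔ (x - two) ≡ 0ℚ
    excess = ℚP.p≥q⇒p⊔q≡p (p≤q⇒p-q≤0 x≤2)
... | inj₂ 2≤x = begin
  ramp x + (0ℚ ⊔ (x - two)) ≡⟨ cong₂ _+_ ramp-x excess ⟩
  two + (x - two)         ≡⟨ p+[q-p]≡q two x ⟩
  x                       ≡⟨ 0⊔x≡x ⟨
  0ℚ ⊔ x                  ∎
  where
    open ≡-Reasoning
    0⊔x≡x : 0ℚ ⊔ x ≡ x
    0⊔x≡x = ℚP.p≤q⇒p⊔q≡q (≤-trans 0≤two 2≤x)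
    ramp-x : ramp x ≡ two
    ramp-x = trans (cong (two ⊓_) 0⊔x≡x) (ℚP.p≤q⇒p⊓q≡p 2≤x)
    excess : 0ℚ ⊔ (x - two) ≡ x - two
    excess = ℚP.p≤q⇒p⊔q≡q (p≤q⇒0≤q-p 2≤x)
    p+[q-p]≡q : ∀ p q → p + (q - p) ≡ q
    p+[q-p]≡q = solve 2 (λ p q → p :+ (q :- p) := q) refl

rampAt : ∀ {n} → ℚ → Fin n → ℚ
rampAt x k = ramp (x - ℕ→ℚ (2 ℕ.* toℕ k))

Σ[Fin]-rampAt : ∀ {n} x → x ≤ ℕ→ℚ (2 ℕ.* n) → Σ[Fin] (rampAt {n} x) ≡ 0ℚ ⊔ x
Σ[Fin]-rampAt {zero}  x x≤0 = sym (ℚP.p≥q⇒p⊔q≡p x≤0)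
Σ[Fin]-rampAt {suc n} x x≤2n+2 = begin
  rampAt {suc n} x F.zero + Σ[Fin] {n} (λ k → rampAt x (F.suc k))
    ≡⟨ cong₂ _+_ (cong ramp (ℚP.+-identityʳ x))
                 (trans (Σ[Fin]-cong shifted) (Σ[Fin]-rampAt {n} (x - two) x-2≤2n)) ⟩
  ramp x + (0ℚ ⊔ (x - two))
    ≡⟨ ramp-+-⊔ x ⟩
  0ℚ ⊔ x ∎
  where
    open ≡-Reasoning
    p-[q+r]≡p-q-r : ∀ p q r → p - (q + r) ≡ p - q - r
    p-[q+r]≡p-q-r = solve 3 (λ p q r → p :- (q :+ r) := p :- q :- r) refl
    shifted : ∀ (k : Fin n) → rampAt x (F.suc k) ≡ rampAt (x - two) k
    shifted k = cong ramp (trans (cong (λ y → x - y) (ℕ→ℚ-2*suc (toℕ k))) (p-[q+r]≡p-q-r x two _))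
    x-2≤2n : x - two ≤ ℕ→ℚ (2 ℕ.* n)
    x-2≤2n = p≤q+r⇒p-q≤r {q = two} (≤-trans x≤2n+2 (≤-reflexive (ℕ→ℚ-2*suc n)))

Φ-summand-ramp : ∀ {P : Set} (p? : Dec P) {x c W} (c<W? : Dec (c < W)) →
              (if ⌊ p? ⌋ ∧ ⌊ c<W? ⌋ then x * (two ⊓ (W - c)) else 0ℚ) ≡
              (if ⌊ p? ⌋ then x else 0ℚ) * ramp (W - c)
Φ-summand-ramp (no _) {c = c} {W} _ = sym (ℚP.*-zeroˡ (ramp (W - c)))
Φ-summand-ramp (yes _) {x} (yes c<W) =
  cong (λ y → x * (two ⊓ y)) (sym (ℚP.p≤q⇒p⊔q≡q (p≤q⇒0≤q-p (<⇒≤ c<W))))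
Φ-summand-ramp (yes _) {x} (no c≮W)  =
  sym (trans (cong (x *_) (ramp-nonPos (p≤q⇒p-q≤0 (ℚP.≮⇒≥ c≮W)))) (ℚP.*-zeroʳ x))

rampAt-exchange : ∀ {n a c W W′} (k : Fin n) → W ≤ W′ → (ℕ→ℚ (2 ℕ.* toℕ k) < W′ → c ≤ a) →
                  a * rampAt W k + c * rampAt W′ k ≤ a * rampAt W′ k + c * rampAt W k
rampAt-exchange {a = a} {c} {W} {W′} k W≤W′ c≤a = [ active , idle ]′ (toSum (2k ℚP.<? W′))
  where
    2k = ℕ→ℚ (2 ℕ.* toℕ k)
    active : 2k < W′ → a * rampAt W k + c * rampAt W′ k ≤ a * rampAt W′ k + c * rampAt W k
    active 2k<W′ = rearrangement (c≤a 2k<W′) (ramp-mono-≤ (+-monoˡ-≤ (- 2k) W≤W′))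
    idle : ¬ (2k < W′) → a * rampAt W k + c * rampAt W′ k ≤ a * rampAt W′ k + c * rampAt W k
    idle 2k≮W′ = ≤-reflexive (cong₂ (λ x y → a * x + c * y)
                                    (trans idle-W (sym idle-W′)) (trans idle-W′ (sym idle-W)))
      where
        W′-2k≤0 : W′ - 2k ≤ 0ℚ
        W′-2k≤0 = p≤q⇒p-q≤0 (ℚP.≮⇒≥ 2k≮W′)
        idle-W′ : rampAt W′ k ≡ 0ℚ
        idle-W′ = ramp-nonPos W′-2k≤0
        idle-W : rampAt W k ≡ 0ℚ
        idle-W = ramp-nonPos (≤-trans (+-monoˡ-≤ (- 2k) W≤W′) W′-2k≤0)

ramps : ∀ {n} → (Fin n → ℚ) → ℚ → ℚ
ramps a W = Σ[Fin] (λ k → a k * rampAt W k)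

module _ {n} {a : Fin n → ℚ} where

  ramps-nonNeg : (∀ k → 0ℚ ≤ a k) → ∀ W → 0ℚ ≤ ramps a W
  ramps-nonNeg 0≤a W = Σ[Fin]-nonNeg (λ k → *-nonNeg (0≤a k) (ramp-nonNeg (W - ℕ→ℚ (2 ℕ.* toℕ k))))

  ramps-≤ : (∀ k → 0ℚ ≤ a k) → ∀ W → ramps a W ≤ Σ[Fin] a * two
  ramps-≤ 0≤a W = ≤-trans
    (Σ[Fin]-mono-≤ (λ k → *-monoˡ-≤ (0≤a k) (ramp-≤-two (W - ℕ→ℚ (2 ℕ.* toℕ k)))))
    (≤-reflexive (sym (*-distribʳ-Σ[Fin] two a)))

  ramps-monoʳ-≤ : (∀ k → 0ℚ ≤ a k) → ∀ {W W′} → W ≤ W′ → ramps a W ≤ ramps a W′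
  ramps-monoʳ-≤ 0≤a W≤W′ =
    Σ[Fin]-mono-≤ (λ k → *-monoˡ-≤ (0≤a k)
                            (ramp-mono-≤ (+-monoˡ-≤ (- ℕ→ℚ (2 ℕ.* toℕ k)) W≤W′)))

  ramps-monoˡ-≤ : ∀ {b : Fin n → ℚ} → (∀ k → a k ≤ b k) → ∀ W → ramps a W ≤ ramps b W
  ramps-monoˡ-≤ a≤b W =
    Σ[Fin]-mono-≤ (λ k → *-monoʳ-≤ (ramp-nonNeg (W - ℕ→ℚ (2 ℕ.* toℕ k))) (a≤b k))

  -- ramps a W′ - ramps a W ≥ c (W′ - W), as ramps a has slope a k on (2k, 2k + 2).
  ramps-slope : ∀ c {W W′} → 0ℚ ≤ W → W ≤ W′ → W′ ≤ ℕ→ℚ (2 ℕ.* n) →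
                (∀ k → ℕ→ℚ (2 ℕ.* toℕ k) < W′ → c ≤ a k) →
                ramps a W + c * W′ ≤ ramps a W′ + c * W
  ramps-slope c {W} {W′} 0≤W W≤W′ W′≤2n c≤a = begin
    ramps a W + c * W′
      ≡⟨ cong (ramps a W +_) (weighted W′ (≤-trans 0≤W W≤W′) W′≤2n) ⟨
    ramps a W + Σ[Fin] {n} (λ k → c * rampAt W′ k)
      ≡⟨ Σ[Fin]-distrib-+ (λ k → a k * rampAt W k) (λ k → c * rampAt W′ k) ⟨
    Σ[Fin] (λ k → a k * rampAt W k + c * rampAt W′ k)
      ≤⟨ Σ[Fin]-mono-≤ (λ k → rampAt-exchange k W≤W′ (c≤a k)) ⟩
    Σ[Fin] (λ k → a k * rampAt W′ k + c * rampAt W k)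
      ≡⟨ Σ[Fin]-distrib-+ (λ k → a k * rampAt W′ k) (λ k → c * rampAt W k) ⟩
    ramps a W′ + Σ[Fin] {n} (λ k → c * rampAt W k)
      ≡⟨ cong (ramps a W′ +_) (weighted W 0≤W (≤-trans W≤W′ W′≤2n)) ⟩
    ramps a W′ + c * W ∎
    where
      open ℚP.≤-Reasoning
      weighted : ∀ x → 0ℚ ≤ x → x ≤ ℕ→ℚ (2 ℕ.* n) → Σ[Fin] {n} (λ k → c * rampAt x k) ≡ c * x
      weighted x 0≤x x≤2n = trans (sym (*-distribˡ-Σ[Fin] c (rampAt {n} x)))
                                  (cong (c *_) (trans (Σ[Fin]-rampAt {n} x x≤2n) (ℚP.p≤q⇒p⊔q≡q 0≤x)))

  ramps-unit-slope : ∀ c {W} → 0ℚ ≤ W → W + 1ℚ ≤ ℕ→ℚ (2 ℕ.* n) →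
                     (∀ k → ℕ→ℚ (2 ℕ.* toℕ k) < W + 1ℚ → c ≤ a k) →
                     ramps a W + c ≤ ramps a (W + 1ℚ)
  ramps-unit-slope c {W} 0≤W W+1≤2n c≤a = +-cancelʳ-≤ (c * W) (≤-trans
    (≤-reflexive (distrib (ramps a W) c W))
    (ramps-slope c 0≤W (p≤p+q (ℚP.nonNegative⁻¹ 1ℚ)) W+1≤2n c≤a))
    where
      distrib : ∀ R c W → R + c + c * W ≡ R + c * (W + 1ℚ)
      distrib = solve 3 (λ R c W → R :+ c :+ c :* W := R :+ c :* (W :+ con 1ℚ)) refl

module Trimming {n} (h : Fin n → ℚ) (cut : ℕ → Fin n)
                (0≤h : ∀ k → 0ℚ ≤ h k) (Σh≡1 : Σ[Fin] h ≡ 1ℚ) where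

  height-cut : ∀ t → height h cut (suc t) (cut t) ≡ 0ℚ
  height-cut t with cut t Data.Fin.≟ cut t
  ... | yes _   = refl
  ... | no  c≢c = ⊥-elim (c≢c refl)

  height-nonNeg : ∀ t i → 0ℚ ≤ height h cut t i
  height-nonNeg zero    i = ≤-refl
  height-nonNeg (suc t) i with i Data.Fin.≟ cut t
  ... | yes _ = ≤-refl
  ... | no  _ = +-mono-≤ (height-nonNeg t i) (0≤h i)

  height-step-≤ : ∀ t i → height h cut (suc t) i ≤ height h cut t i + h i
  height-step-≤ t i with i Data.Fin.≟ cut t
  ... | yes _ = +-mono-≤ (height-nonNeg t i) (0≤h i)
  ... | no  _ = ≤-refl

  capped : ℕ → Fin n → ℚ
  capped t k = two ⊓ height h cut t k

  capped-nonNeg : ∀ t k → 0ℚ ≤ capped t k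
  capped-nonNeg t k = ℚP.⊓-glb 0≤two (height-nonNeg t k)

  capped-cut : ∀ t → capped (suc t) (cut t) ≡ 0ℚ
  capped-cut t = trans (cong (two ⊓_) (height-cut t)) (ℚP.p≥q⇒p⊓q≡q 0≤two)

  capped-step : ∀ t k → capped (suc t) k ≤ capped t k + h k
  capped-step t k with k Data.Fin.≟ cut t
  ... | yes _ = ≤-trans (≤-reflexive (ℚP.p≥q⇒p⊓q≡q 0≤two)) (+-mono-≤ (capped-nonNeg t k) (0≤h k))
  ... | no  _ = ≤-trans (ℚP.⊓-monoˡ-≤ (height h cut t k + h k) (p≤p+q {two} (0≤h k)))
                        (≤-reflexive (sym (⊓-distribʳ-+ two (height h cut t k) (h k))))

  V-nonNeg : ∀ i t → 0ℚ ≤ V h cut i t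
  V-nonNeg i t = Σ[Fin]-nonNeg (prefix-nonNeg (capped-nonNeg t) i)

  V-≤ : ∀ i t → V h cut i t ≤ ℕ→ℚ (2 ℕ.* suc (toℕ i))
  V-≤ i t = Σ[Fin]-prefix-≤ (λ k → ℚP.p⊓q≤p two (height h cut t k)) i

  V-mono-index : ∀ {i j} t → toℕ i ℕ.≤ toℕ j → V h cut i t ≤ V h cut j t
  V-mono-index t i≤j = Σ[Fin]-mono-≤ (prefix-mono-index (capped-nonNeg t) i≤j)

  Σ[Fin]-prefix-h≤1 : ∀ i → Σ[Fin] (prefix i h) ≤ 1ℚ
  Σ[Fin]-prefix-h≤1 i = ≤-trans (Σ[Fin]-mono-≤ (prefix-≤ 0≤h i)) (≤-reflexive Σh≡1)

  V-drop : ∀ {t j} → toℕ (cut t) ℕ.≤ toℕ j → two ≤ height h cut t (cut t) + h (cut t) →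
           V h cut j (suc t) + 1ℚ ≤ V h cut j t
  V-drop {t} {j} c≤j 2≤grown = +-cancelʳ-≤ 1ℚ (begin
    V h cut j (suc t) + 1ℚ + 1ℚ
      ≡⟨ ℚP.+-assoc (V h cut j (suc t)) 1ℚ 1ℚ ⟩
    V h cut j (suc t) + two
      ≤⟨ Σ[Fin]-mono-≤-at (prefix-mono (capped-step t) j) c at-cut ⟩
    Σ[Fin] (prefix j (λ k → capped t k + h k))
      ≡⟨ Σ[Fin]-cong (prefix-+ h j) ⟩
    Σ[Fin] (λ k → prefix j (capped t) k + prefix j h k)
      ≡⟨ Σ[Fin]-distrib-+ (prefix j (capped t)) (prefix j h) ⟩
    V h cut j t + Σ[Fin] (prefix j h)
      ≤⟨ +-monoʳ-≤ (V h cut j t) (Σ[Fin]-prefix-h≤1 j) ⟩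
    V h cut j t + 1ℚ ∎)
    where
      open ℚP.≤-Reasoning
      c = cut t
      at-cut : prefix j (capped (suc t)) c + two ≤ prefix j (λ k → capped t k + h k) c
      at-cut = begin
        prefix j (capped (suc t)) c + two
          ≡⟨ cong (_+ two) (trans (prefix-inside {f = capped (suc t)} j c c≤j) (capped-cut t)) ⟩
        0ℚ + two
          ≡⟨ ℚP.+-identityˡ two ⟩
        two
          ≤⟨ ℚP.⊓-glb (p≤p+q {two} (0≤h c)) 2≤grown ⟩
        (two + h c) ⊓ (height h cut t c + h c)
          ≡⟨ ⊓-distribʳ-+ two (height h cut t c) (h c) ⟨
        capped t c + h c
          ≡⟨ prefix-inside {f = λ k → capped t k + h k} j c c≤j ⟨
        prefix j (λ k → capped t k + h k) c ∎

  Φ-ramps : ∀ i t → Φ h cut i t ≡ ramps (prefix i h) (V h cut i t)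
  Φ-ramps i t = Σ[Fin]-cong {n} (λ k →
    Φ-summand-ramp (toℕ k ℕP.≤? toℕ i) (ℕ→ℚ (2 ℕ.* toℕ k) ℚP.<? V h cut i t))

  Φ-nonNeg : ∀ i t → 0ℚ ≤ Φ h cut i t
  Φ-nonNeg i t = ≤-trans (ramps-nonNeg (prefix-nonNeg 0≤h i) (V h cut i t))
                         (≤-reflexive (sym (Φ-ramps i t)))

  Φ-≤-two : ∀ i t → Φ h cut i t ≤ two
  Φ-≤-two i t = begin
    Φ h cut i t                                ≡⟨ Φ-ramps i t ⟩
    ramps (prefix i h) (V h cut i t)           ≤⟨ ramps-≤ (prefix-nonNeg 0≤h i) (V h cut i t) ⟩
    Σ[Fin] (prefix i h) * two                  ≤⟨ *-monoʳ-≤ 0≤two (Σ[Fin]-prefix-h≤1 i) ⟩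
    1ℚ * two                                   ≡⟨ ℚP.*-identityˡ two ⟩
    two                                        ∎
    where open ℚP.≤-Reasoning

module ReduceMax {n} (h : Fin n → ℚ) (cut : ℕ → Fin n)
                 (h-anti : ∀ i j → toℕ i ℕ.≤ toℕ j → h j ≤ h i)
                 (0≤h : ∀ k → 0ℚ ≤ h k) (Σh≡1 : Σ[Fin] h ≡ 1ℚ)
                 (reduceMax : IsReduceMax h cut) where

  open Trimming h cut 0≤h Σh≡1 public

  four : ℚ
  four = ℕ→ℚ 4

  prefix-unit-slope : ∀ j {W} → 0ℚ ≤ W → W + 1ℚ ≤ ℕ→ℚ (2 ℕ.* suc (toℕ j)) →
                      ramps (prefix j h) W + h j ≤ ramps (prefix j h) (W + 1ℚ)
  prefix-unit-slope j {W} 0≤W W+1≤2j+2 =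
    ramps-unit-slope (h j) 0≤W (≤-trans W+1≤2j+2 (ℕ→ℚ-mono-≤ (ℕP.*-monoʳ-≤ 2 (toℕ<n j)))) hj≤
    where
      hj≤ : ∀ k → ℕ→ℚ (2 ℕ.* toℕ k) < W + 1ℚ → h j ≤ prefix j h k
      hj≤ k 2k<W+1 = ≤-trans (h-anti k j k≤j) (≤-reflexive (sym (prefix-inside {f = h} j k k≤j)))
        where
          k≤j : toℕ k ℕ.≤ toℕ j
          k≤j = ℕP.m<1+n⇒m≤n (ℕP.*-cancelˡ-< 2 _ _ (ℕ→ℚ-cancel-< (ℚP.<-≤-trans 2k<W+1 W+1≤2j+2)))

  Invariant : ℕ → Set
  Invariant t = ∀ i → height h cut t i + Φ h cut i t ≤ four

  tall-cut-bound : ∀ {t i j} → Invariant t → toℕ i ℕ.≤ toℕ j → toℕ (cut t) ℕ.≤ toℕ j →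
                   two ≤ height h cut t (cut t) + h (cut t) →
                   height h cut t j + h j + Φ h cut i (suc t) ≤ four
  tall-cut-bound {t} {i} {j} inv i≤j c≤j 2≤grown = begin
    Hj + h j + Φ h cut i (suc t)
      ≡⟨ cong (Hj + h j +_) (Φ-ramps i (suc t)) ⟩
    Hj + h j + ramps (prefix i h) W
      ≤⟨ +-monoʳ-≤ (Hj + h j) (ramps-monoˡ-≤ (prefix-mono-index 0≤h i≤j) W) ⟩
    Hj + h j + ramps (prefix j h) W
      ≡⟨ swap Hj (h j) (ramps (prefix j h) W) ⟩
    Hj + (ramps (prefix j h) W + h j)
      ≤⟨ +-monoʳ-≤ Hj (prefix-unit-slope j (V-nonNeg i (suc t)) (≤-trans W+1≤Vj (V-≤ j t))) ⟩
    Hj + ramps (prefix j h) (W + 1ℚ)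
      ≤⟨ +-monoʳ-≤ Hj (ramps-monoʳ-≤ (prefix-nonNeg 0≤h j) W+1≤Vj) ⟩
    Hj + ramps (prefix j h) (V h cut j t)
      ≡⟨ cong (Hj +_) (Φ-ramps j t) ⟨
    Hj + Φ h cut j t
      ≤⟨ inv j ⟩
    four ∎
    where
      open ℚP.≤-Reasoning
      Hj = height h cut t j
      W = V h cut i (suc t)
      W+1≤Vj : W + 1ℚ ≤ V h cut j t
      W+1≤Vj = ≤-trans (+-monoˡ-≤ 1ℚ (V-mono-index (suc t) i≤j)) (V-drop c≤j 2≤grown)
      swap : ∀ a b c → a + b + c ≡ a + (c + b)
      swap = solve 3 (λ a b c → a :+ b :+ c := a :+ (c :+ b)) refl

  grown-bound : ∀ {t} → Invariant t → ∀ i → height h cut t i + h i + Φ h cut i (suc t) ≤ four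
  grown-bound {t} inv i = [ small , tall ]′ (ℚP.≤-total (height h cut t i + h i) two)
    where
      small : height h cut t i + h i ≤ two → height h cut t i + h i + Φ h cut i (suc t) ≤ four
      small grown≤2 = +-mono-≤ grown≤2 (Φ-≤-two i (suc t))
      tall : two ≤ height h cut t i + h i → height h cut t i + h i + Φ h cut i (suc t) ≤ four
      tall 2≤grown = [ cut-below , cut-above ]′ (ℕP.≤-total (toℕ (cut t)) (toℕ i))
        where
          2≤cut : two ≤ height h cut t (cut t) + h (cut t)
          2≤cut = ≤-trans 2≤grown (reduceMax t i)
          cut-below : toℕ (cut t) ℕ.≤ toℕ i → height h cut t i + h i + Φ h cut i (suc t) ≤ four
          cut-below c≤i = tall-cut-bound {t} inv ℕP.≤-refl c≤i 2≤cut
          cut-above : toℕ i ℕ.≤ toℕ (cut t) → height h cut t i + h i + Φ h cut i (suc t) ≤ four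
          cut-above i≤c = ≤-trans (+-monoˡ-≤ (Φ h cut i (suc t)) (reduceMax t i))
                                  (tall-cut-bound {t} inv i≤c ℕP.≤-refl 2≤cut)

  invariant : ∀ t → Invariant t
  invariant zero    i = +-mono-≤ 0≤two (Φ-≤-two i zero)
  invariant (suc t) i =
    ≤-trans (+-monoˡ-≤ (Φ h cut i (suc t)) (height-step-≤ t i)) (grown-bound {t} (invariant t) i)

lemma2p2 : (n : ℕ) → 1 ℕ.≤ n →
    (h : Fin n → ℚ) →
    (∀ i j → toℕ i ℕ.≤ toℕ j → h j ≤ h i) →
    (∀ i → 0ℚ < h i) →
    Σ[Fin] h ≡ 1ℚ →
    (cut : ℕ → Fin n) → IsReduceMax h cut →
    ∀ (i : Fin n) (t : ℕ) →
      (height h cut t i ≤ ℕ→ℚ 4 - Φ h cut i t) × (ℕ→ℚ 4 - Φ h cut i t ≤ ℕ→ℚ 4)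
lemma2p2 n _ h h-anti 0<h Σh≡1 cut reduceMax i t =
  p+q≤r⇒p≤r-q (invariant t i) , p-q≤p (Φ-nonNeg i t)
  where
    0≤h : ∀ k → 0ℚ ≤ h k
    0≤h k = <⇒≤ (0<h k)
    open ReduceMax h cut h-anti 0≤h Σh≡1 reduceMax
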